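{- Let $G$ be a connected $\{K_{1,3},Z_{2},N\}$-free graph which contains an induced subgraph $H=H_{2}(\{C_{t_{3}},C_{t_{4}}\})$, where $C_{t_{3}},C_{t_{4}}$ are vertex-disjoint nonempty cliques. Then for each vertex $a\in V(G)\setminus V(H)$ with $N_{G}(a)\cap V(H)\neq\emptyset$, one of the following holds: (i) $G[V(H)\cup\{a\}]\in\mathcal{H}_{2}$; (ii) for some $i\in\{3,4\}$, $N_{G}(a)\cap V(H)=\{t_{1},t_{i+2}\}\cup C_{t_{i}}$ and $|C_{t_{7-i}}|=1$ (and so $G[V(H)\cup\{a\}]\in\mathcal{H}_{5}$); (iii) $N_{G}(a)\cap V(H)=\{t_{1},t_{2},t_{5},t_{6}\}$ and $|C_{t_{3}}|=|C_{t_{4}}|=1$ (and so $G[V(H)\cup\{a\}]\in\mathcal{H}_{6}$).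
   Context: All graphs are finite and simple; $N_G(a)$ is the neighborhood of $a$, $G[X]$ the induced subgraph. $\mathcal{F}$-free means no member of $\mathcal{F}$ is an induced subgraph. $K_{1,3}$ is the star with three leaves; $Z_2$ is a triangle $abc$ plus a path $ade$ on new vertices $d,e$; $N$ is a triangle with one new pendant vertex attached to each of its three vertices. Expansion: for a graph $H$, expandable set $U\subseteq V(H)$, and pairwise disjoint nonempty cliques $\mathcal{C}=\{C_a\mid a\in U\}$, $H(\mathcal{C})$ replaces each $a\in U$ by the clique $C_a$: a vertex of $C_a$ is adjacent to $u\in V(H)\setminus U$ iff $au\in E(H)$; for distinct $a,b\in U$, $C_a$ is completely joined to $C_b$ if $ab\in E(H)$ and has no edges to it otherwise; other adjacencies as in $H$. $H_2$: vertices $t_1,\dots,t_6$, edges $t_1t_2,t_2t_3,t_2t_4,t_3t_4,t_3t_5,t_4t_6,t_5t_6$; $U_2=\{t_3,t_4\}$. $H_5$: vertices $w_1,\dots,w_7$, edges $w_1w_3,w_1w_5,w_3w_4,w_5w_6,w_2w_4,w_2w_6,w_7w_3,w_7w_4,w_7w_5,w_7w_6$; $U_5=\{w_7\}$. $H_6$: vertices $x_1,\dots,x_7$, edges $x_1x_2,x_1x_3,x_1x_5,x_3x_5,x_3x_4,x_2x_4,x_2x_6,x_4x_6,x_5x_6,x_5x_7,x_6x_7$. For $i\in\{2,5\}$, $\mathcal{H}_i$ is the family of graphs isomorphic to some $H_i(\mathcal{C})$ with $\mathcal{C}=\{C_a\mid a\in U_i\}$ pairwise disjoint nonempty cliques;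 $\mathcal{H}_6=\{H_6\}$ (up to isomorphism). -}

module Defs where

open import Data.Nat using (ℕ; _≤_)
open import Data.Fin using (Fin; #_; _≟_)
open import Data.Bool using (Bool; true; false; _∧_; _∨_; not)
open import Data.List using (List; []; _∷_)
open import Data.Bool.ListAction using (any)
open import Data.Product using (Σ; ∃; _×_; _,_; proj₁; proj₂)
open import Data.Product.Properties using (≡-dec)
open import Data.Sum using (_⊎_)
open import Relation.Nullary using (¬_)
open import Relation.Nullary.Decidable using (⌊_⌋)
open import Relation.Binary.PropositionalEquality using (_≡_; _≢_)
open import Function.Bundles using (_↔_; Inverse)
open import Function.Definitions using (Injective)

record Graph (V : Set) : Set where
  field
    adj : V → V → Bool
open Graph public

IsSimple : ∀ {V} → Graph V → Set
IsSimple {V} G = (∀ x y → adj G x y ≡ adj G y x) × (∀ x → adj G x x ≡ false)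

data Walk {V : Set} (G : Graph V) : V → V → Set where
  here : ∀ {x} → Walk G x x
  step : ∀ {x y z} → adj G x y ≡ true → Walk G y z → Walk G x z

Connected : ∀ {V} → Graph V → Set
Connected {V} G = ∀ (x y : V) → Walk G x y

induced : ∀ {V} → Graph V → (X : V → Set) → Graph (Σ V X)
adj (induced G X) p q = adj G (proj₁ p) (proj₁ q)

IsInducedEmbedding : ∀ {W V} → Graph W → Graph V → (W → V) → Set
IsInducedEmbedding F G f =
  Injective _≡_ _≡_ f × (∀ x y → adj F x y ≡ adj G (f x) (f y))

Free : ∀ {V W} → Graph V → Graph W → Set
Free {V} {W} G F = ¬ (Σ (W → V) λ f → IsInducedEmbedding F G f)

_≅_ : ∀ {V W} → Graph V → Graph W → Set
_≅_ {V} {W} G F =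
  Σ (V ↔ W) λ b → ∀ x y → adj G x y ≡ adj F (Inverse.to b x) (Inverse.to b y)

eqb : ∀ {k} → Fin k → Fin k → Bool
eqb x y = ⌊ x ≟ y ⌋

fromEdges : ∀ k → List (Fin k × Fin k) → Graph (Fin k)
adj (fromEdges k es) x y =
  not (eqb x y) ∧
  any (λ e → (eqb x (proj₁ e) ∧ eqb y (proj₂ e)) ∨ (eqb x (proj₂ e) ∧ eqb y (proj₁ e))) es

inSet : ∀ {k} → List (Fin k) → Fin k → Bool
inSet xs y = any (eqb y) xs

-- Expansion H(𝒞): vertex a of the base graph H is replaced by a clique of
-- size sz a (the clique C_a); only the sizes matter up to isomorphism.

ExpV : ∀ {k} → (Fin k → ℕ) → Set
ExpV {k} sz = Σ (Fin k) (λ a → Fin (sz a))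

Exp : ∀ {k} → Graph (Fin k) → (sz : Fin k → ℕ) → Graph (ExpV sz)
adj (Exp H sz) p q =
  not ⌊ ≡-dec _≟_ _≟_ p q ⌋ ∧ (eqb (proj₁ p) (proj₁ q) ∨ adj H (proj₁ p) (proj₁ q))

Admissible : ∀ {k} → (U : Fin k → Bool) → (Fin k → ℕ) → Set
Admissible U sz = ∀ a → (U a ≡ true → 1 ≤ sz a) × (U a ≡ false → sz a ≡ 1)

InClass : ∀ {k V} → Graph (Fin k) → (Fin k → Bool) → Graph V → Set
InClass H U G' = Σ (_ → ℕ) λ sz → Admissible U sz × (G' ≅ Exp H sz)

K13 : Graph (Fin 4)
K13 = fromEdges 4 ((# 0 , # 1) ∷ (# 0 , # 2) ∷ (# 0 , # 3) ∷ [])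

Z2 : Graph (Fin 5)
Z2 = fromEdges 5 ((# 0 , # 1) ∷ (# 1 , # 2) ∷ (# 0 , # 2) ∷ (# 0 , # 3) ∷ (# 3 , # 4) ∷ [])

NN : Graph (Fin 6)
NN = fromEdges 6 ((# 0 , # 1) ∷ (# 1 , # 2) ∷ (# 0 , # 2) ∷
                  (# 0 , # 3) ∷ (# 1 , # 4) ∷ (# 2 , # 5) ∷ [])

t1 t2 t3 t4 t5 t6 : Fin 6
t1 = # 0
t2 = # 1
t3 = # 2
t4 = # 3
t5 = # 4
t6 = # 5

H2 : Graph (Fin 6)
H2 = fromEdges 6 ((t1 , t2) ∷ (t2 , t3) ∷ (t2 , t4) ∷ (t3 , t4) ∷
                  (t3 , t5) ∷ (t4 , t6) ∷ (t5 , t6) ∷ [])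

U2 : Fin 6 → Bool
U2 = inSet (t3 ∷ t4 ∷ [])

-- H5 on w1..w7 = 0..6
H5 : Graph (Fin 7)
H5 = fromEdges 7 ((# 0 , # 2) ∷ (# 0 , # 4) ∷ (# 2 , # 3) ∷ (# 4 , # 5) ∷
                  (# 1 , # 3) ∷ (# 1 , # 5) ∷ (# 6 , # 2) ∷ (# 6 , # 3) ∷
                  (# 6 , # 4) ∷ (# 6 , # 5) ∷ [])

U5 : Fin 7 → Bool
U5 = inSet (# 6 ∷ [])

-- H6 on x1..x7 = 0..6
H6 : Graph (Fin 7)
H6 = fromEdges 7 ((# 0 , # 1) ∷ (# 0 , # 2) ∷ (# 0 , # 4) ∷ (# 2 , # 4) ∷
                  (# 2 , # 3) ∷ (# 1 , # 3) ∷ (# 1 , # 5) ∷ (# 3 , # 5) ∷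
                  (# 4 , # 5) ∷ (# 4 , # 6) ∷ (# 5 , # 6) ∷ [])

HplusA : ∀ {n} {sz : Fin 6 → ℕ} → (ExpV sz → Fin n) → Fin n → Fin n → Set
HplusA {sz = sz} f a v = (Σ (ExpV sz) λ p → f p ≡ v) ⊎ (v ≡ a)

-- N_G(a) ∩ V(H) = ⋃_{x ∈ S} (image of the clique/vertex x)
NbrIs : ∀ {n} {sz : Fin 6 → ℕ} → Graph (Fin n) → Fin n → (ExpV sz → Fin n) →
        (Fin 6 → Bool) → Set
NbrIs {sz = sz} G a f S = ∀ (p : ExpV sz) → adj G a (f p) ≡ S (proj₁ p)

-- Choose one point in every clique of H.  Together with a these seven vertices induce
-- a {K₁,₃, Z₂}-free graph, and an exhaustive check leaves exactly six possible traces
-- of N(a) on them.  The points of t₁, t₂, t₅, t₆ are the same for every choice, and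
-- their four traces already determine which of the six occurs, so N(a) ∩ V(H) is a
-- union of whole cliques; it is nonempty by assumption.  If a is a true twin of t₃ or
-- t₄ it just enlarges that clique (case (i)).  In the other three cases two points of
-- C_{t₃} or C_{t₄} would induce a Z₂ with a, which gives the singleton conditions, and
-- G[V(H) ∪ {a}] is a relabelled expansion of H₅ or H₆.

module Submission where

open import Defs
open import Data.Nat using (ℕ; zero; suc; _≤_; s≤s; z≤n)
open import Data.Nat.Properties using (≤-reflexive)
open import Data.Fin using (Fin; zero; suc; _≟_; fromℕ<)
open import Data.Fin.Patterns using (0F; 1F; 2F; 3F; 4F; 5F; 6F)
open import Data.Fin.Properties using (all?; suc-injective)
open import Data.Bool using (Bool; true; false; _∧_; _∨_; not)
open import Data.Bool.Properties using () renaming (_≟_ to _≟ᵇ_)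
open import Data.List using ([]; _∷_)
open import Data.Vec using (Vec; lookup; tabulate) renaming (_∷_ to _∷ᵥ_; [] to []ᵥ)
open import Data.Vec.Properties using (lookup∘tabulate)
open import Data.Vec.Functional using () renaming (_∷_ to _◂_)
open import Data.Maybe using (Maybe; just; nothing; maybe)
open import Data.Product using (Σ; _×_; _,_; proj₁; proj₂)
open import Data.Product.Properties using (≡-dec)
open import Data.Product.Function.Dependent.Propositional using (Σ-↔)
open import Data.Sum using (_⊎_; inj₁; inj₂; [_,_]′)
open import Data.Empty using (⊥; ⊥-elim)
open import Relation.Nullary using (¬_; Dec; yes; no; contradiction)
open import Relation.Nullary.Decidable
  using (⌊_⌋; isYes≗does; dec-true; True; toWitness; from-yes; map′; _×-dec_; _→-dec_)
open import Relation.Binary.PropositionalEquality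
  using (_≡_; _≢_; refl; sym; trans; cong; cong₂; subst; module ≡-Reasoning)
open import Function using (_∘_; id; _∋_)
open import Function.Bundles using (_↔_; Inverse; mk↔ₛ′; Injection)
open import Function.Properties.Inverse using (↔-refl; ↔-trans; ↔⇒↣)

isYes-cong : ∀ {P Q : Set} → (P → Q) → (Q → P) → (p? : Dec P) (q? : Dec Q) → ⌊ p? ⌋ ≡ ⌊ q? ⌋
isYes-cong _   _   (yes _) (yes _) = refl
isYes-cong _   _   (no _)  (no _)  = refl
isYes-cong p→q _   (yes p) (no ¬q) = contradiction (p→q p) ¬q
isYes-cong _   q→p (no ¬p) (yes q) = contradiction (q→p q) ¬p

isYes-true : ∀ {P : Set} (p? : Dec P) → P → ⌊ p? ⌋ ≡ true
isYes-true p? p = trans (isYes≗does p?) (dec-true p? p)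

eqb-refl : ∀ {k} (x : Fin k) → eqb x x ≡ true
eqb-refl x = isYes-true (x ≟ x) refl

eqb-sym : ∀ {k} (x y : Fin k) → eqb x y ≡ eqb y x
eqb-sym x y = isYes-cong sym sym (x ≟ y) (y ≟ x)

eqb-suc : ∀ {k} (x y : Fin k) → eqb (suc x) (suc y) ≡ eqb x y
eqb-suc x y = isYes-cong suc-injective (cong suc) (suc x ≟ suc y) (x ≟ y)

Fin-unique : ∀ {k} → k ≡ 1 → (i j : Fin k) → i ≡ j
Fin-unique refl zero zero = refl

one-or-two : ∀ {k} → 1 ≤ k → k ≡ 1 ⊎ Σ (Fin k) λ i → Σ (Fin k) λ j → i ≢ j
one-or-two {suc zero}    _ = inj₁ refl
one-or-two {suc (suc _)} _ = inj₂ (zero , suc zero , λ ())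

to-injective : ∀ {A B : Set} (φ : A ↔ B) {x y : A} → Inverse.to φ x ≡ Inverse.to φ y → x ≡ y
to-injective φ = Injection.injective (↔⇒↣ φ)

closedAdj : ∀ {k} → Graph (Fin k) → Fin k → Fin k → Bool
closedAdj H u v = eqb u v ∨ adj H u v

closedAdj-sym : ∀ {k} {H : Graph (Fin k)} → (∀ u v → adj H u v ≡ adj H v u) →
                ∀ u v → closedAdj H u v ≡ closedAdj H v u
closedAdj-sym H-sym u v = cong₂ _∨_ (eqb-sym u v) (H-sym u v)

extend : ∀ {k} → Graph (Fin k) → (Fin k → Bool) → Graph (Fin (suc k))
adj (extend H S) zero    zero    = false
adj (extend H S) zero    (suc v) = S v
adj (extend H S) (suc u) zero    = S u
adj (extend H S) (suc u) (suc v) = adj H u v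

-- The subgraph of an expansion of H induced on distinct points with classes cls.
classGraph : ∀ {k m} → Graph (Fin k) → (Fin m → Fin k) → Graph (Fin m)
adj (classGraph H cls) i j = not (eqb i j) ∧ closedAdj H (cls i) (cls j)

≅-trans : ∀ {U V W} {G : Graph U} {G′ : Graph V} {G″ : Graph W} → G ≅ G′ → G′ ≅ G″ → G ≅ G″
≅-trans (φ , φ-adj) (ψ , ψ-adj) =
  ↔-trans φ ψ , λ x y → trans (φ-adj x y) (ψ-adj (Inverse.to φ x) (Inverse.to φ y))

Free-induced : ∀ {U V W} {M : Graph U} {G : Graph V} {F : Graph W} {v : U → V} →
               IsInducedEmbedding M G v → Free G F → Free M F
Free-induced (v-inj , v-adj) G-free (w , w-inj , w-adj) =
  G-free (_ , (λ e → w-inj (v-inj e)) , λ x y → trans (w-adj x y) (v-adj _ _))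

embedding? : ∀ {k m} (F : Graph (Fin k)) (M : Graph (Fin m)) (w : Fin k → Fin m) →
             Dec (IsInducedEmbedding F M w)
embedding? F M w =
  map′ (λ inj {x} {y} → inj x y) (λ inj x y → inj)
       (all? λ x → all? λ y → w x ≟ w y →-dec x ≟ y)
  ×-dec all? (λ x → all? λ y → adj F x y ≟ᵇ adj M (w x) (w y))

-- A record rather than a product, so that unification can recover the graph from it.
record ClawZ₂Free {V : Set} (G : Graph V) : Set where
  constructor _,_
  field
    no-claw : Free G K13
    no-Z₂   : Free G Z2

ClawZ₂Free-induced : ∀ {U V} {M : Graph U} {G : Graph V} {v : U → V} →
                     IsInducedEmbedding M G v → ClawZ₂Free G → ClawZ₂Free M
ClawZ₂Free-induced {G = G} v-emb (no-claw , no-Z₂) =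
  Free-induced {G = G} v-emb no-claw , Free-induced {G = G} v-emb no-Z₂

induced-claw : ∀ {m} {M : Graph (Fin m)} → ClawZ₂Free M → (c x y z : Fin m) →
               {True (embedding? K13 M (lookup (c ∷ᵥ x ∷ᵥ y ∷ᵥ z ∷ᵥ []ᵥ)))} → ⊥
induced-claw M-free c x y z {ok} = ClawZ₂Free.no-claw M-free (_ , toWitness ok)

induced-Z₂ : ∀ {m} {M : Graph (Fin m)} → ClawZ₂Free M → (a b c d e : Fin m) →
             {True (embedding? Z2 M (lookup (a ∷ᵥ b ∷ᵥ c ∷ᵥ d ∷ᵥ e ∷ᵥ []ᵥ)))} → ⊥
induced-Z₂ M-free a b c d e {ok} = ClawZ₂Free.no-Z₂ M-free (_ , toWitness ok)

≅-from-tables : ∀ {k} (K K′ : Graph (Fin k)) (to from : Vec (Fin k) k) →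
  {True (all? λ y → lookup to (lookup from y) ≟ y)} →
  {True (all? λ x → lookup from (lookup to x) ≟ x)} →
  {True (all? λ u → all? λ v → adj K u v ≟ᵇ adj K′ (lookup to u) (lookup to v))} →
  K ≅ K′
≅-from-tables K K′ to from {inv-l} {inv-r} {pres} =
  mk↔ₛ′ (lookup to) (lookup from) (toWitness inv-l) (toWitness inv-r) , toWitness pres

Exp-≅ : ∀ {k k′} {H : Graph (Fin k)} {H′ : Graph (Fin k′)} {sz : Fin k → ℕ} {sz′ : Fin k′ → ℕ}
        (φ : ExpV sz ↔ ExpV sz′) (π : Fin k → Fin k′) →
        (∀ p → proj₁ (Inverse.to φ p) ≡ π (proj₁ p)) →
        (∀ u v → closedAdj H u v ≡ closedAdj H′ (π u) (π v)) →
        Exp H sz ≅ Exp H′ sz′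
Exp-≅ {H′ = H′} φ π over preserves = φ , λ p q →
  cong₂ (λ same close → not same ∧ close)
    (isYes-cong (cong to) (to-injective φ) (≡-dec _≟_ _≟_ p q) (≡-dec _≟_ _≟_ (to p) (to q)))
    (trans (preserves (proj₁ p) (proj₁ q)) (sym (cong₂ (closedAdj H′) (over p) (over q))))
  where open Inverse φ using (to)

Exp-relabel : ∀ {k k′} {H : Graph (Fin k)} {H′ : Graph (Fin k′)} {sz : Fin k → ℕ} →
              (iso : H ≅ H′) → Exp H sz ≅ Exp H′ (sz ∘ Inverse.from (proj₁ iso))
Exp-relabel {H′ = H′} {sz} (π , π-adj) =
  Exp-≅ {H′ = H′} (Σ-↔ π fibre) (Inverse.to π) (λ _ → refl)
        (λ u v → cong₂ _∨_ (isYes-cong (cong (Inverse.to π)) (to-injective π) (u ≟ v) _) (π-adj u v))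
  where
  fibre : ∀ {x} → Fin (sz x) ↔ Fin (sz (Inverse.from π (Inverse.to π x)))
  fibre {x} = subst (λ y → Fin (sz x) ↔ Fin (sz y)) (sym (Inverse.strictlyInverseʳ π x)) ↔-refl

Exp-singletons : ∀ {k} {H : Graph (Fin k)} {sz : Fin k → ℕ} →
                 (∀ x → adj H x x ≡ false) → (∀ x → sz x ≡ 1) → Exp H sz ≅ H
Exp-singletons {H = H} {sz} loopless one = mk↔ₛ′ proj₁ point (λ _ → refl) point-proj₁ , adjacency
  where
  point : ∀ x → ExpV sz
  point x = x , subst Fin (sym (one x)) zero
  point-proj₁ : ∀ p → point (proj₁ p) ≡ p
  point-proj₁ (x , i) = cong (x ,_) (Fin-unique (one x) _ i)
  adjacency : ∀ p q → adj (Exp H sz) p q ≡ adj H (proj₁ p) (proj₁ q)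
  adjacency (x , i) (y , j) =
    trans (cong (λ same → not same ∧ closedAdj H x y)
                (isYes-cong (cong proj₁) (λ { refl → cong (x ,_) (Fin-unique (one x) i j) })
                            (≡-dec _≟_ _≟_ (x , i) (y , j)) (x ≟ y)))
          (loops-vanish (x ≟ y))
    where
    loops-vanish : (x≟y : Dec (x ≡ y)) → not ⌊ x≟y ⌋ ∧ (⌊ x≟y ⌋ ∨ adj H x y) ≡ adj H x y
    loops-vanish (yes refl) = sym (loopless x)
    loops-vanish (no _)     = refl

Admissible-nonempty : ∀ {k} {U : Fin k → Bool} {sz : Fin k → ℕ} → Admissible U sz → ∀ x → 1 ≤ sz x
Admissible-nonempty {U = U} adm x with U x | adm x
... | true  | (nonempty , _) = nonempty refl
... | false | (_ , single)   = ≤-reflexive (sym (single refl))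

bump : ∀ {k} → Fin k → (Fin k → ℕ) → Fin k → ℕ
bump zero    sz zero    = suc (sz zero)
bump zero    sz (suc y) = sz (suc y)
bump (suc x) sz zero    = sz zero
bump (suc x) sz (suc y) = bump x (sz ∘ suc) y

bump-admissible : ∀ {k} {U : Fin k → Bool} {sz : Fin k → ℕ} (x : Fin k) →
                  U x ≡ true → Admissible U sz → Admissible U (bump x sz)
bump-admissible zero    Ux  _   zero    =
  (λ _ → s≤s z≤n) , λ Ux≡false → contradiction (trans (sym Ux) Ux≡false) λ ()
bump-admissible zero    _   adm (suc y) = adm (suc y)
bump-admissible (suc x) _   adm zero    = adm zero
bump-admissible (suc x) Ux  adm (suc y) = bump-admissible x Ux (adm ∘ suc) y

-- Fin (bump x sz y) is Fin (sz y) plus, when y = x, the point new x sz; unbump undoes old.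
new : ∀ {k} (x : Fin k) (sz : Fin k → ℕ) → Fin (bump x sz x)
new zero    sz = zero
new (suc x) sz = new x (sz ∘ suc)

old : ∀ {k} (x : Fin k) (sz : Fin k → ℕ) (y : Fin k) → Fin (sz y) → Fin (bump x sz y)
old zero    sz zero    = suc
old zero    sz (suc y) = id
old (suc x) sz zero    = id
old (suc x) sz (suc y) = old x (sz ∘ suc) y

unbump : ∀ {k} (x : Fin k) (sz : Fin k → ℕ) (y : Fin k) → Fin (bump x sz y) → Maybe (Fin (sz y))
unbump zero    sz zero    zero    = nothing
unbump zero    sz zero    (suc i) = just i
unbump zero    sz (suc y) i       = just i
unbump (suc x) sz zero    i       = just i
unbump (suc x) sz (suc y) i       = unbump x (sz ∘ suc) y i

unbump-new : ∀ {k} (x : Fin k) sz → unbump x sz x (new x sz) ≡ nothing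
unbump-new zero    sz = refl
unbump-new (suc x) sz = unbump-new x (sz ∘ suc)

unbump-old : ∀ {k} (x : Fin k) sz y i → unbump x sz y (old x sz y i) ≡ just i
unbump-old zero    sz zero    i = refl
unbump-old zero    sz (suc y) i = refl
unbump-old (suc x) sz zero    i = refl
unbump-old (suc x) sz (suc y) i = unbump-old x (sz ∘ suc) y i

unbump-nothing : ∀ {k} (x : Fin k) sz y j → unbump x sz y j ≡ nothing →
                 (ExpV (bump x sz) ∋ (y , j)) ≡ (x , new x sz)
unbump-nothing zero    sz zero    zero    _ = refl
unbump-nothing (suc x) sz (suc y) j       e =
  cong (λ { (y , j) → suc y , j }) (unbump-nothing x (sz ∘ suc) y j e)

unbump-just : ∀ {k} (x : Fin k) sz y j {i} → unbump x sz y j ≡ just i → old x sz y i ≡ j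
unbump-just zero    sz zero    (suc i) refl = refl
unbump-just zero    sz (suc y) i       refl = refl
unbump-just (suc x) sz zero    i       refl = refl
unbump-just (suc x) sz (suc y) j       e    = unbump-just x (sz ∘ suc) y j e

Exp-absorb-twin : ∀ {k} {H : Graph (Fin k)} {sz : Fin k → ℕ} (x : Fin k) →
                  (∀ u v → adj H u v ≡ adj H v u) →
                  Exp (extend H (closedAdj H x)) (1 ◂ sz) ≅ Exp H (bump x sz)
Exp-absorb-twin {k} {H} {sz} x H-sym =
  Exp-≅ {H′ = H} (mk↔ₛ′ to from to∘from from∘to) π
        (λ { (zero , _) → refl ; (suc _ , _) → refl }) preserves
  where
  to : ExpV (1 ◂ sz) → ExpV (bump x sz)
  to (zero  , _) = x , new x sz
  to (suc y , i) = y , old x sz y i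
  from : ExpV (bump x sz) → ExpV (1 ◂ sz)
  from (y , j) = maybe (λ i → suc y , i) (zero , zero) (unbump x sz y j)
  to∘from : ∀ p → to (from p) ≡ p
  to∘from (y , j) with unbump x sz y j in e
  ... | just i  = cong (y ,_) (unbump-just x sz y j e)
  ... | nothing = sym (unbump-nothing x sz y j e)
  from∘to : ∀ p → from (to p) ≡ p
  from∘to (zero  , zero) = cong (maybe _ _) (unbump-new x sz)
  from∘to (suc y , i)    = cong (maybe _ _) (unbump-old x sz y i)
  π : Fin (suc k) → Fin k
  π zero    = x
  π (suc y) = y
  preserves : ∀ u v → closedAdj (extend H (closedAdj H x)) u v ≡ closedAdj H (π u) (π v)
  preserves zero    zero    = sym (cong (_∨ adj H x x) (eqb-refl x))
  preserves zero    (suc v) = refl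
  preserves (suc u) zero    = closedAdj-sym H-sym x u
  preserves (suc u) (suc v) = cong (_∨ adj H u v) (eqb-suc u v)

Exp-extend-suc : ∀ {k} {H : Graph (Fin k)} {S : Fin k → Bool} {s : ℕ} {sz : Fin k → ℕ} (p q : ExpV sz) →
                 adj (Exp (extend H S) (s ◂ sz)) (suc (proj₁ p) , proj₂ p) (suc (proj₁ q) , proj₂ q)
                   ≡ adj (Exp H sz) p q
Exp-extend-suc {H = H} (y , i) (y′ , j) =
  cong₂ (λ same close → not same ∧ close)
        (isYes-cong (λ { refl → refl }) (λ { refl → refl })
                    (≡-dec _≟_ _≟_ (suc y , i) (suc y′ , j)) (≡-dec _≟_ _≟_ (y , i) (y′ , j)))
        (cong (_∨ adj H y y′) (eqb-suc y y′))

module OutsideVertex {k n} {H : Graph (Fin k)} {G : Graph (Fin n)} (G-simple : IsSimple G)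
  {sz : Fin k → ℕ} {f : ExpV sz → Fin n} (f-emb : IsInducedEmbedding (Exp H sz) G f)
  {a : Fin n} (a∉f : ∀ p → f p ≢ a) where

  view : ∀ {m} → (Fin m → ExpV sz) → Fin (suc m) → Fin n
  view ps zero    = a
  view ps (suc i) = f (ps i)

  view-embedding : ∀ {m} (ps : Fin m → ExpV sz) (cls : Fin m → Fin k) (bits : Fin m → Bool) →
                   (∀ i → proj₁ (ps i) ≡ cls i) → (∀ {i j} → ps i ≡ ps j → i ≡ j) →
                   (∀ i → bits i ≡ adj G a (f (ps i))) →
                   IsInducedEmbedding (extend (classGraph H cls) bits) G (view ps)
  view-embedding ps cls bits over ps-inj sees = injective , adjacency
    where
    injective : ∀ {x y} → view ps x ≡ view ps y → x ≡ y
    injective {zero}  {zero}  _ = refl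
    injective {zero}  {suc j} e = contradiction (sym e) (a∉f (ps j))
    injective {suc i} {zero}  e = contradiction e (a∉f (ps i))
    injective {suc i} {suc j} e = cong suc (ps-inj (proj₁ f-emb e))
    adjacency : ∀ x y → adj (extend (classGraph H cls) bits) x y ≡ adj G (view ps x) (view ps y)
    adjacency zero    zero    = sym (proj₂ G-simple a)
    adjacency zero    (suc j) = sees j
    adjacency (suc i) zero    = trans (sees i) (proj₁ G-simple a (f (ps i)))
    adjacency (suc i) (suc j) =
      trans (cong₂ (λ same close → not same ∧ close)
                   (isYes-cong (cong ps) ps-inj (i ≟ j) (≡-dec _≟_ _≟_ (ps i) (ps j)))
                   (sym (cong₂ (closedAdj H) (over i) (over j))))
            (proj₂ f-emb (ps i) (ps j))

HplusA-≅ : ∀ {n} {G : Graph (Fin n)} {H : Graph (Fin 6)} {sz : Fin 6 → ℕ} {f : ExpV sz → Fin n}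
             {a : Fin n} {S : Fin 6 → Bool} →
           IsSimple G → IsInducedEmbedding (Exp H sz) G f → (∀ p → f p ≢ a) → NbrIs G a f S →
           induced G (HplusA f a) ≅ Exp (extend H S) (1 ◂ sz)
HplusA-≅ {n} {G} {H} {sz} {f} {a} {S} (G-sym , G-loopless) (_ , f-adj) a∉f sees =
  mk↔ₛ′ to from to∘from from∘to , adjacency
  where
  to : Σ (Fin n) (HplusA f a) → ExpV (1 ◂ sz)
  to (_ , inj₁ ((y , i) , _)) = suc y , i
  to (_ , inj₂ _)             = zero , zero
  from : ExpV (1 ◂ sz) → Σ (Fin n) (HplusA f a)
  from (zero  , _) = a , inj₂ refl
  from (suc y , i) = f (y , i) , inj₁ ((y , i) , refl)
  to∘from : ∀ p → to (from p) ≡ p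
  to∘from (zero  , zero) = refl
  to∘from (suc y , i)    = refl
  from∘to : ∀ x → from (to x) ≡ x
  from∘to (_ , inj₁ (_ , refl)) = refl
  from∘to (_ , inj₂ refl)       = refl
  adjacency : ∀ x y → adj G (proj₁ x) (proj₁ y) ≡ adj (Exp (extend H S) (1 ◂ sz)) (to x) (to y)
  adjacency (_ , inj₁ (p , refl)) (_ , inj₁ (q , refl)) =
    trans (sym (f-adj p q)) (sym (Exp-extend-suc {H = H} {S} p q))
  adjacency (_ , inj₁ (p , refl)) (_ , inj₂ refl)       = trans (G-sym (f p) a) (sees p)
  adjacency (_ , inj₂ refl)       (_ , inj₁ (q , refl)) = sees q
  adjacency (_ , inj₂ refl)       (_ , inj₂ refl)       = G-loopless a

data Attachment : Set where
  none twin₃ twin₄ typeH5₃ typeH5₄ typeH6 : Attachment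

nbrSet : Attachment → Fin 6 → Bool
nbrSet none    = λ _ → false
nbrSet twin₃   = closedAdj H2 t3
nbrSet twin₄   = closedAdj H2 t4
nbrSet typeH5₃ = inSet (t1 ∷ t5 ∷ t3 ∷ [])
nbrSet typeH5₄ = inSet (t1 ∷ t6 ∷ t4 ∷ [])
nbrSet typeH6  = inSet (t1 ∷ t2 ∷ t5 ∷ t6 ∷ [])

decode : Bool → Bool → Bool → Bool → Attachment
decode false true  true  false = twin₃
decode false true  false true  = twin₄
decode true  false true  false = typeH5₃
decode true  false false true  = typeH5₄
decode true  true  true  true  = typeH6
decode _     _     _     _     = none

decode-nbrSet : ∀ P → decode (nbrSet P t1) (nbrSet P t2) (nbrSet P t5) (nbrSet P t6) ≡ P
decode-nbrSet none    = refl
decode-nbrSet twin₃   = refl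
decode-nbrSet twin₄   = refl
decode-nbrSet typeH5₃ = refl
decode-nbrSet typeH5₄ = refl
decode-nbrSet typeH6  = refl

-- Vertex 0 is a and vertex j is the point of C_{t_j}; every trace other than the six
-- attachments is refuted by an induced claw or Z₂ on the listed vertices.
TransversalModel : Vec Bool 6 → Graph (Fin 7)
TransversalModel b = extend (classGraph H2 id) (lookup b)

classify : ∀ b₁ b₂ b₃ b₄ b₅ b₆ → let b = b₁ ∷ᵥ b₂ ∷ᵥ b₃ ∷ᵥ b₄ ∷ᵥ b₅ ∷ᵥ b₆ ∷ᵥ []ᵥ in
           ClawZ₂Free (TransversalModel b) → Σ Attachment λ P → b ≡ tabulate (nbrSet P)
classify false false false false false false _    = none , refl
classify false false false false false true  free = ⊥-elim (induced-claw free 6F 0F 4F 5F)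
classify false false false false true  _     free = ⊥-elim (induced-Z₂ free 3F 2F 4F 5F 0F)
classify true  false false false _     _     free = ⊥-elim (induced-Z₂ free 2F 3F 4F 1F 0F)
classify _     false false true  _     false free = ⊥-elim (induced-claw free 4F 0F 2F 6F)
classify false false false true  _     true  free = ⊥-elim (induced-Z₂ free 4F 0F 6F 2F 1F)
classify true  false false true  false true  _    = typeH5₄ , refl
classify true  false false true  true  true  free = ⊥-elim (induced-claw free 0F 1F 4F 5F)
classify _     false true  _     false _     free = ⊥-elim (induced-claw free 3F 0F 2F 5F)
classify false false true  _     true  _     free = ⊥-elim (induced-Z₂ free 3F 0F 5F 2F 1F)
classify true  false true  false true  false _    = typeH5₃ , refl
classify true  false true  false true  true  free = ⊥-elim (induced-claw free 0F 1F 3F 6F)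
classify true  false true  true  true  _     free = ⊥-elim (induced-claw free 0F 1F 4F 5F)
classify false true  false _     _     _     free = ⊥-elim (induced-claw free 2F 0F 1F 3F)
classify false true  true  false _     _     free = ⊥-elim (induced-claw free 2F 0F 1F 4F)
classify false true  true  true  false false free = ⊥-elim (induced-Z₂ free 3F 0F 2F 5F 6F)
classify false true  true  true  false true  _    = twin₄ , refl
classify false true  true  true  true  false _    = twin₃ , refl
classify false true  true  true  true  true  free = ⊥-elim (induced-Z₂ free 0F 5F 6F 2F 1F)
classify true  true  false _     false _     free = ⊥-elim (induced-Z₂ free 2F 0F 1F 3F 5F)
classify true  true  false false true  false free = ⊥-elim (induced-claw free 5F 0F 3F 6F)
classify true  true  false false true  true  _    = typeH6 , refl
classify true  true  false true  true  _     free = ⊥-elim (induced-claw free 0F 1F 4F 5F)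
classify true  true  true  _     false false free = ⊥-elim (induced-Z₂ free 3F 0F 2F 5F 6F)
classify true  true  true  _     true  false free = ⊥-elim (induced-Z₂ free 0F 1F 2F 5F 6F)
classify true  true  true  _     _     true  free = ⊥-elim (induced-claw free 0F 1F 3F 6F)

H2-symmetric : ∀ u v → adj H2 u v ≡ adj H2 v u
H2-symmetric = from-yes (all? λ u → all? λ v → adj H2 u v ≟ᵇ adj H2 v u)

-- The tables give the images of a, t₁, …, t₆ and the inverse permutation.
extend-typeH5₃≅H5 : extend H2 (nbrSet typeH5₃) ≅ H5
extend-typeH5₃≅H5 = ≅-from-tables (extend H2 (nbrSet typeH5₃)) H5
  (2F ∷ᵥ 0F ∷ᵥ 4F ∷ᵥ 6F ∷ᵥ 5F ∷ᵥ 3F ∷ᵥ 1F ∷ᵥ []ᵥ)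
  (1F ∷ᵥ 6F ∷ᵥ 0F ∷ᵥ 5F ∷ᵥ 2F ∷ᵥ 4F ∷ᵥ 3F ∷ᵥ []ᵥ)

extend-typeH5₄≅H5 : extend H2 (nbrSet typeH5₄) ≅ H5
extend-typeH5₄≅H5 = ≅-from-tables (extend H2 (nbrSet typeH5₄)) H5
  (2F ∷ᵥ 0F ∷ᵥ 4F ∷ᵥ 5F ∷ᵥ 6F ∷ᵥ 1F ∷ᵥ 3F ∷ᵥ []ᵥ)
  (1F ∷ᵥ 5F ∷ᵥ 0F ∷ᵥ 6F ∷ᵥ 2F ∷ᵥ 3F ∷ᵥ 4F ∷ᵥ []ᵥ)

extend-typeH6≅H6 : extend H2 (nbrSet typeH6) ≅ H6
extend-typeH6≅H6 = ≅-from-tables (extend H2 (nbrSet typeH6)) H6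
  (4F ∷ᵥ 6F ∷ᵥ 5F ∷ᵥ 1F ∷ᵥ 3F ∷ᵥ 0F ∷ᵥ 2F ∷ᵥ []ᵥ)
  (5F ∷ᵥ 3F ∷ᵥ 6F ∷ᵥ 4F ∷ᵥ 0F ∷ᵥ 2F ∷ᵥ 1F ∷ᵥ []ᵥ)

module AttachedVertex {n} {G : Graph (Fin n)} (G-simple : IsSimple G) (G-free : ClawZ₂Free G)
  {sz : Fin 6 → ℕ} (adm : Admissible U2 sz)
  {f : ExpV sz → Fin n} (f-emb : IsInducedEmbedding (Exp H2 sz) G f)
  {a : Fin n} (a∉f : ∀ p → f p ≢ a) where

  open OutsideVertex G-simple f-emb a∉f

  point : ∀ x → Fin (sz x)
  point x = fromℕ< (Admissible-nonempty adm x)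

  outer : ∀ x → U2 x ≡ false → sz x ≡ 1
  outer x = proj₂ (adm x)

  transversal : Fin (sz t3) → Fin (sz t4) → (x : Fin 6) → Fin (sz x)
  transversal c d 2F = c
  transversal c d 3F = d
  transversal c d x  = point x

  -- The points of t₁, t₂, t₅, t₆ lie in every transversal, so this one attachment is
  -- the classification of all of them.
  attachment : Attachment
  attachment = decode (sees-point 0F) (sees-point 1F) (sees-point 4F) (sees-point 5F)
    where
    sees-point : Fin 6 → Bool
    sees-point x = adj G a (f (x , point x))

  sees-transversal : ∀ c d x → adj G a (f (x , transversal c d x)) ≡ nbrSet attachment x
  sees-transversal c d x = begin
    β x                            ≡⟨ sym (lookup∘tabulate β x) ⟩
    lookup (tabulate β) x          ≡⟨ cong (λ b → lookup b x) β≡P ⟩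
    lookup (tabulate (nbrSet P)) x ≡⟨ lookup∘tabulate (nbrSet P) x ⟩
    nbrSet P x                     ≡⟨ cong (λ Q → nbrSet Q x) P≡attachment ⟩
    nbrSet attachment x            ∎
    where
    open ≡-Reasoning
    β : Fin 6 → Bool
    β y = adj G a (f (y , transversal c d y))
    model-free : ClawZ₂Free (TransversalModel (tabulate β))
    model-free = ClawZ₂Free-induced
      (view-embedding (λ y → y , transversal c d y) id (lookup (tabulate β))
                      (λ _ → refl) (cong proj₁) (lookup∘tabulate β))
      G-free
    classified : Σ Attachment λ P → tabulate β ≡ tabulate (nbrSet P)
    classified = classify (β 0F) (β 1F) (β 2F) (β 3F) (β 4F) (β 5F) model-free
    P : Attachment
    P = proj₁ classified
    β≡P : tabulate β ≡ tabulate (nbrSet P)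
    β≡P = proj₂ classified
    P≡attachment : P ≡ attachment
    P≡attachment = trans (sym (decode-nbrSet P))
      (cong (λ b → decode (lookup b 0F) (lookup b 1F) (lookup b 4F) (lookup b 5F)) (sym β≡P))

  sees-outer : ∀ x → U2 x ≡ false → (i : Fin (sz x)) → adj G a (f (x , i)) ≡ adj G a (f (x , point x))
  sees-outer x Ux i = cong (λ j → adj G a (f (x , j))) (Fin-unique (outer x Ux) i (point x))

  sees : NbrIs G a f (nbrSet attachment)
  sees (0F , i) = trans (sees-outer 0F refl i) (sees-transversal (point 2F) (point 3F) 0F)
  sees (1F , i) = trans (sees-outer 1F refl i) (sees-transversal (point 2F) (point 3F) 1F)
  sees (2F , c) = sees-transversal c (point 3F) 2F
  sees (3F , d) = sees-transversal (point 2F) d 3F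
  sees (4F , i) = trans (sees-outer 4F refl i) (sees-transversal (point 2F) (point 3F) 4F)
  sees (5F , i) = trans (sees-outer 5F refl i) (sees-transversal (point 2F) (point 3F) 5F)

  singleton-clique : (u v x : Fin 6) {S : Fin 6 → Bool} → NbrIs G a f S → u ≢ v → u ≢ x → v ≢ x →
    let cls = u ∷ᵥ v ∷ᵥ x ∷ᵥ x ∷ᵥ []ᵥ in
    ¬ ClawZ₂Free (extend (classGraph H2 (lookup cls)) (S ∘ lookup cls)) →
    sz x ≡ 1
  singleton-clique u v x {S} sees-S u≢v u≢x v≢x not-free =
    [ id , (λ (i , j , i≢j) → ⊥-elim (two-points i j i≢j)) ]′ (one-or-two (Admissible-nonempty adm x))
    where
    two-points : (i j : Fin (sz x)) → i ≢ j → ⊥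
    two-points i j i≢j = not-free (ClawZ₂Free-induced
      (view-embedding ps (lookup (u ∷ᵥ v ∷ᵥ x ∷ᵥ x ∷ᵥ []ᵥ)) _
         (λ { 0F → refl ; 1F → refl ; 2F → refl ; 3F → refl }) injective
         (λ { 0F → sym (sees-S _) ; 1F → sym (sees-S _) ; 2F → sym (sees-S _) ; 3F → sym (sees-S _) }))
      G-free)
      where
      ps : Fin 4 → ExpV sz
      ps = lookup ((u , point u) ∷ᵥ (v , point v) ∷ᵥ (x , i) ∷ᵥ (x , j) ∷ᵥ []ᵥ)
      injective : ∀ {r s} → ps r ≡ ps s → r ≡ s
      injective {0F} {0F} _ = refl
      injective {0F} {1F} e = contradiction (cong proj₁ e) u≢v
      injective {0F} {2F} e = contradiction (cong proj₁ e) u≢x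
      injective {0F} {3F} e = contradiction (cong proj₁ e) u≢x
      injective {1F} {0F} e = contradiction (cong proj₁ (sym e)) u≢v
      injective {1F} {1F} _ = refl
      injective {1F} {2F} e = contradiction (cong proj₁ e) v≢x
      injective {1F} {3F} e = contradiction (cong proj₁ e) v≢x
      injective {2F} {0F} e = contradiction (cong proj₁ (sym e)) u≢x
      injective {2F} {1F} e = contradiction (cong proj₁ (sym e)) v≢x
      injective {2F} {2F} _ = refl
      injective {2F} {3F} refl = contradiction refl i≢j
      injective {3F} {0F} e = contradiction (cong proj₁ (sym e)) u≢x
      injective {3F} {1F} e = contradiction (cong proj₁ (sym e)) v≢x
      injective {3F} {2F} refl = contradiction refl i≢j
      injective {3F} {3F} _ = refl

  HplusA≅ : ∀ {S} → NbrIs G a f S → induced G (HplusA f a) ≅ Exp (extend H2 S) (1 ◂ sz)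
  HplusA≅ = HplusA-≅ G-simple f-emb a∉f

  absorbed : ∀ x → U2 x ≡ true → NbrIs G a f (closedAdj H2 x) → InClass H2 U2 (induced G (HplusA f a))
  absorbed x Ux sees-x =
    bump x sz , bump-admissible x Ux adm ,
    ≅-trans {G″ = Exp H2 (bump x sz)} (HplusA≅ sees-x) (Exp-absorb-twin x H2-symmetric)

  relabelled-H5 : ∀ {S} (iso : extend H2 S ≅ H5) → NbrIs G a f S →
                  Admissible U5 ((1 ◂ sz) ∘ Inverse.from (proj₁ iso)) → InClass H5 U5 (induced G (HplusA f a))
  relabelled-H5 iso sees-S admissible =
    _ , admissible , ≅-trans {G″ = Exp H5 _} (HplusA≅ sees-S) (Exp-relabel {H′ = H5} iso)

  Conclusion : Set
  Conclusion = InClass H2 U2 (induced G (HplusA f a))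
    ⊎ (NbrIs G a f (inSet (t1 ∷ t5 ∷ t3 ∷ [])) × sz t4 ≡ 1
         × InClass H5 U5 (induced G (HplusA f a)))
    ⊎ (NbrIs G a f (inSet (t1 ∷ t6 ∷ t4 ∷ [])) × sz t3 ≡ 1
         × InClass H5 U5 (induced G (HplusA f a)))
    ⊎ (NbrIs G a f (inSet (t1 ∷ t2 ∷ t5 ∷ t6 ∷ [])) × sz t3 ≡ 1 × sz t4 ≡ 1
         × (induced G (HplusA f a) ≅ H6))

  conclusion : ∀ P → NbrIs G a f (nbrSet P) → Σ (ExpV sz) (λ p → adj G a (f p) ≡ true) → Conclusion
  conclusion none sees-P (p , a~p) = contradiction (trans (sym (sees-P p)) a~p) λ ()
  conclusion twin₃ sees-P _ = inj₁ (absorbed t3 refl sees-P)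
  conclusion twin₄ sees-P _ = inj₁ (absorbed t4 refl sees-P)
  conclusion typeH5₃ sees-P _ =
    inj₂ (inj₁ (sees-P , sz₄≡1 , relabelled-H5 extend-typeH5₃≅H5 sees-P admissible))
    where
    sz₄≡1 : sz t4 ≡ 1
    sz₄≡1 = singleton-clique t1 t2 t4 sees-P (λ ()) (λ ()) (λ ()) λ free → induced-Z₂ free 2F 3F 4F 1F 0F
    admissible : Admissible U5 ((1 ◂ sz) ∘ Inverse.from (proj₁ extend-typeH5₃≅H5))
    admissible 0F = (λ ()) , λ _ → outer t1 refl
    admissible 1F = (λ ()) , λ _ → outer t6 refl
    admissible 2F = (λ ()) , λ _ → refl
    admissible 3F = (λ ()) , λ _ → outer t5 refl
    admissible 4F = (λ ()) , λ _ → outer t2 refl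
    admissible 5F = (λ ()) , λ _ → sz₄≡1
    admissible 6F = (λ _ → Admissible-nonempty adm t3) , λ ()
  conclusion typeH5₄ sees-P _ =
    inj₂ (inj₂ (inj₁ (sees-P , sz₃≡1 , relabelled-H5 extend-typeH5₄≅H5 sees-P admissible)))
    where
    sz₃≡1 : sz t3 ≡ 1
    sz₃≡1 = singleton-clique t1 t2 t3 sees-P (λ ()) (λ ()) (λ ()) λ free → induced-Z₂ free 2F 3F 4F 1F 0F
    admissible : Admissible U5 ((1 ◂ sz) ∘ Inverse.from (proj₁ extend-typeH5₄≅H5))
    admissible 0F = (λ ()) , λ _ → outer t1 refl
    admissible 1F = (λ ()) , λ _ → outer t5 refl
    admissible 2F = (λ ()) , λ _ → refl
    admissible 3F = (λ ()) , λ _ → outer t6 refl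
    admissible 4F = (λ ()) , λ _ → outer t2 refl
    admissible 5F = (λ ()) , λ _ → sz₃≡1
    admissible 6F = (λ _ → Admissible-nonempty adm t4) , λ ()
  conclusion typeH6 sees-P _ =
    inj₂ (inj₂ (inj₂ (sees-P , sz₃≡1 , sz₄≡1 , ≅-trans {G″ = H6} (HplusA≅ sees-P) collapse)))
    where
    sz₃≡1 : sz t3 ≡ 1
    sz₃≡1 = singleton-clique t2 t6 t3 sees-P (λ ()) (λ ()) (λ ()) λ free → induced-Z₂ free 1F 3F 4F 0F 2F
    sz₄≡1 : sz t4 ≡ 1
    sz₄≡1 = singleton-clique t2 t5 t4 sees-P (λ ()) (λ ()) (λ ()) λ free → induced-Z₂ free 1F 3F 4F 0F 2F
    singletons : ∀ y → (1 ◂ sz) y ≡ 1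
    singletons 0F = refl
    singletons 1F = outer t1 refl
    singletons 2F = outer t2 refl
    singletons 3F = sz₃≡1
    singletons 4F = sz₄≡1
    singletons 5F = outer t5 refl
    singletons 6F = outer t6 refl
    loopless : ∀ x → adj (extend H2 (nbrSet typeH6)) x x ≡ false
    loopless = from-yes (all? λ x → adj (extend H2 (nbrSet typeH6)) x x ≟ᵇ false)
    collapse : Exp (extend H2 (nbrSet typeH6)) (1 ◂ sz) ≅ H6
    collapse = ≅-trans {G″ = H6} (Exp-singletons loopless singletons) extend-typeH6≅H6

lemma2p3 : ∀ {n} (G : Graph (Fin n)) → IsSimple G → Connected G →
    Free G K13 → Free G Z2 → Free G NN →
    (sz : Fin 6 → ℕ) → Admissible U2 sz →
    (f : ExpV sz → Fin n) → IsInducedEmbedding (Exp H2 sz) G f →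
    (a : Fin n) → (∀ p → f p ≢ a) → Σ (ExpV sz) (λ p → adj G a (f p) ≡ true) →
    InClass H2 U2 (induced G (HplusA f a))
    ⊎ (NbrIs G a f (inSet (t1 ∷ t5 ∷ t3 ∷ [])) × sz t4 ≡ 1
         × InClass H5 U5 (induced G (HplusA f a)))
    ⊎ (NbrIs G a f (inSet (t1 ∷ t6 ∷ t4 ∷ [])) × sz t3 ≡ 1
         × InClass H5 U5 (induced G (HplusA f a)))
    ⊎ (NbrIs G a f (inSet (t1 ∷ t2 ∷ t5 ∷ t6 ∷ [])) × sz t3 ≡ 1 × sz t4 ≡ 1
         × (induced G (HplusA f a) ≅ H6))
lemma2p3 G G-simple _ no-claw no-Z₂ _ sz adm f f-emb a a∉f a-has-neighbour =
  conclusion attachment sees a-has-neighbour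
  where open AttachedVertex G-simple (no-claw , no-Z₂) adm f-emb a∉f
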